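{- Let $G$ be a finite simple undirected graph, $\mathcal{M}$ a given MCB, and $C_1,C_2\in\mathcal{C}_{\mathcal{R}}$ with $|C_1|=|C_2|$. Then $C_1$ and $C_2$ are short loop-interchangeable if and only if their expansions in $\mathcal{M}$ are equal up to shorter cycles, i.e., every cycle in the symmetric difference $\mathcal{E}_{\mathcal{M}}(C_1)\,\triangle\,\mathcal{E}_{\mathcal{M}}(C_2)$ has length strictly less than $|C_1|$.
   Context: Let $G=(V,E)$ be a finite simple undirected graph. A cycle is a set $C\subseteq E$ such that every vertex of $G$ has even degree in the subgraph with edge set $C$; $|C|$ denotes the number of edges. The cycles form a vector space over $GF(2)$ under symmetric difference $\oplus$. A minimum cycle basis (MCB) is a basis $\mathcal{M}$ of this space minimizing $\sum_{B\in\mathcal{M}}|B|$. The set of relevant cycles $\mathcal{C}_{\mathcal{R}}$ is the union of all MCBs. For a basis $\mathcal{B}$ and a cycle $C$, $\mathcal{E}_{\mathcal{B}}(C)$ denotes the unique subset of $\mathcal{B}$ whose $\oplus$-sum is $C$. Two cycles $C_1,C_2\in\mathcal{C}_{\mathcal{R}}$ with $|C_1|=|C_2|$ are short loop-interchangeable if there is a finite set $\mathcal{Y}$ of cycles, each of length $<|C_1|$, with $C_1=C_2\oplus\bigoplus_{C\in\mathcal{Y}}C$. -}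

module Defs where

open import Data.Nat using (ℕ; zero; suc; _+_; _<_; _≤_)
open import Data.Nat.Divisibility using (_∣_)
open import Data.Bool using (Bool; true; false; if_then_else_; _∧_; _∨_; _xor_)
open import Data.Fin using (Fin; _≟_)
open import Data.Fin.Subset using (Subset; ∣_∣; ⊥)
open import Data.List using (List; map; foldr)
open import Data.Nat.ListAction using (sum)
open import Data.List.Relation.Unary.All using (All)
open import Data.Vec using (lookup; zipWith)
open import Data.Vec.Functional using () renaming (Vector to FVec)
open import Data.List using (allFin) renaming (_∷_ to _∷ₗ_)
open import Data.Product using (Σ; _×_; ∃; ∃-syntax; _,_)
open import Data.Sum using (_⊎_)
open import Relation.Binary.PropositionalEquality using (_≡_; _≢_)
open import Relation.Nullary.Decidable using (⌊_⌋)

record Graph : Set where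
  field
    n m : ℕ
    src tgt : Fin m → Fin n
    noLoop : ∀ e → src e ≢ tgt e
    noParallel : ∀ e e′ →
      ((src e ≡ src e′ × tgt e ≡ tgt e′) ⊎ (src e ≡ tgt e′ × tgt e ≡ src e′)) → e ≡ e′

module _ (G : Graph) where
  open Graph G

  EdgeSet : Set
  EdgeSet = Subset m

  _⊕_ : EdgeSet → EdgeSet → EdgeSet
  A ⊕ B = zipWith _xor_ A B

  len : EdgeSet → ℕ
  len C = ∣ C ∣

  incident : Fin m → Fin n → Bool
  incident e v = ⌊ src e ≟ v ⌋ ∨ ⌊ tgt e ≟ v ⌋

  degree : EdgeSet → Fin n → ℕ
  degree C v = sum (map (λ e → if lookup C e ∧ incident e v then 1 else 0) (allFin m))

  IsCycle : EdgeSet → Set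
  IsCycle C = ∀ v → 2 ∣ degree C v

  ⨁ : List EdgeSet → EdgeSet
  ⨁ = foldr _⊕_ ⊥

  sumSel : ∀ {k} → FVec EdgeSet k → Subset k → EdgeSet
  sumSel {k} B S = foldr (λ i acc → if lookup S i then B i ⊕ acc else acc) ⊥ (allFin k)

  record IsBasis {k : ℕ} (B : FVec EdgeSet k) : Set where
    field
      cycles      : ∀ i → IsCycle (B i)
      independent : ∀ (S : Subset k) → sumSel B S ≡ ⊥ → S ≡ ⊥
      spanning    : ∀ C → IsCycle C → ∃[ S ] sumSel B S ≡ C

  weight : ∀ {k} → FVec EdgeSet k → ℕ
  weight {k} B = sum (map (λ i → len (B i)) (allFin k))

  IsMCB : ∀ {k} → FVec EdgeSet k → Set
  IsMCB B = IsBasis B × (∀ {k′} (B′ : FVec EdgeSet k′) → IsBasis B′ → weight B ≤ weight B′)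

  Relevant : EdgeSet → Set
  Relevant C = ∃[ k ] Σ (FVec EdgeSet k) λ B → IsMCB B × ∃[ i ] B i ≡ C

  -- S is the expansion E_B(C) of C in the basis B (unique by independence)
  IsExpansion : ∀ {k} → FVec EdgeSet k → EdgeSet → Subset k → Set
  IsExpansion B C S = sumSel B S ≡ C

  ShortLoopInterchangeable : EdgeSet → EdgeSet → Set
  ShortLoopInterchangeable C₁ C₂ =
    ∃[ Y ] All (λ C → IsCycle C × len C < len C₁) Y × (C₁ ≡ C₂ ⊕ ⨁ Y)

-- Exchange property: if the basis element M j of a minimum cycle basis occurs in the
-- expansion S of a cycle C, then replacing M j by C gives again a cycle basis (its
-- expansions are those of M composed with the transvection T ↦ T + T_j (S + e_j)), so
-- minimality forces |M j| ≤ |C|. Hence the expansion of a sum of cycles shorter than L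
-- only involves basis elements shorter than L; conversely such an expansion exhibits
-- its cycle as a sum of short cycles, namely basis elements. Applied to C₁ ⊕ C₂, whose
-- expansion is E(C₁) △ E(C₂), this is the theorem.
module Submission where

open import Defs
open import Data.Nat using (ℕ; _<_)
open import Data.Fin using (Fin)
open import Data.Fin.Subset using (Subset)
open import Data.Vec using (lookup)
open import Data.Vec.Functional using (Vector)
open import Data.Bool using (_xor_; true)
open import Data.Product using (_×_)
open import Function.Bundles using (_⇔_)
open import Relation.Binary.PropositionalEquality using (_≡_)

open import Algebra.Bundles using (AbelianGroup)
open import Algebra.Core using (Op₂)
open import Algebra.Structures using (IsAbelianGroup)
import Algebra.Properties.AbelianGroup as AbelianGroupProperties
import Algebra.Properties.CommutativeSemigroup as CommutativeSemigroupProperties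
open import Data.Bool using (false; if_then_else_)
open import Data.Bool.Properties using (xor-assoc; xor-comm; xor-identityˡ; xor-identityʳ; xor-same)
open import Data.Fin using (zero; suc; _≟_)
open import Data.Fin.Subset using (⊥; ⁅_⁆)
open import Data.Fin.Subset.Properties using (x∈⁅x⁆)
open import Data.List using ([]; _∷_; foldr; map; tabulate; allFin)
open import Data.List.Properties using (foldr-map; map-tabulate; tabulate-cong)
open import Data.List.Relation.Unary.All using (All; []; _∷_)
open import Data.Nat using (zero; suc; _≤_)
open import Data.Nat.ListAction using (sum)
open import Data.Nat.Properties using (+-monoˡ-<; +-monoʳ-<; ≤-<-trans; ≮⇒≥; <⇒≱; module ≤-Reasoning)
open import Data.Product using (∃-syntax; _,_; proj₁; map₂)
open import Data.Vec using ([]; _∷_; zipWith)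
open import Data.Vec.Properties using (zipWith-assoc; zipWith-comm; zipWith-identityˡ; zipWith-identityʳ; lookup-zipWith; lookup-replicate; []=⇒lookup)
open import Data.Vec.Functional using (tail; updateAt)
open import Data.Vec.Functional.Properties using (updateAt-updates; updateAt-minimal; map-updateAt-local)
open import Function using (id; const; _∘_; mk⇔; Equivalence)
open import Function.Properties.Equivalence using () renaming (trans to ⇔-trans)
open import Level using (0ℓ)
open import Relation.Nullary using (yes; no; contradiction)
open import Relation.Binary.PropositionalEquality using (refl; sym; trans; cong; cong₂; subst; module ≡-Reasoning)
open import Relation.Binary.PropositionalEquality.Algebra using (isMagma)

infixl 6 _△_

-- `_⊕_ G` and `⨁ G` unfold to `_△_` and `foldr _△_ ⊥`.
_△_ : ∀ {n} → Op₂ (Subset n)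
_△_ = zipWith _xor_

△-self : ∀ {n} (x : Subset n) → x △ x ≡ ⊥
△-self []      = refl
△-self (b ∷ x) = cong₂ _∷_ (xor-same b) (△-self x)

△-isAbelianGroup : ∀ n → IsAbelianGroup _≡_ (_△_ {n}) ⊥ id
△-isAbelianGroup n = record
  { isGroup = record
    { isMonoid = record
      { isSemigroup = record { isMagma = isMagma _△_ ; assoc = zipWith-assoc xor-assoc }
      ; identity    = zipWith-identityˡ xor-identityˡ , zipWith-identityʳ xor-identityʳ
      }
    ; inverse = △-self , △-self
    ; ⁻¹-cong = cong id
    }
  ; comm = zipWith-comm xor-comm
  }

△-abelianGroup : ℕ → AbelianGroup 0ℓ 0ℓ
△-abelianGroup n = record { isAbelianGroup = △-isAbelianGroup n }

module △ {n : ℕ} where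
  open AbelianGroup (△-abelianGroup n) public using (assoc; comm; identityˡ)
  open AbelianGroupProperties (△-abelianGroup n) public
    using (x∙y⁻¹≈ε⇒x≈y; \\-leftDividesˡ; //-rightDividesʳ)
  open CommutativeSemigroupProperties (AbelianGroup.commutativeSemigroup (△-abelianGroup n)) public
    using (interchange; x∙yz≈y∙xz)

△-cancelˡ : ∀ {n} (x y : Subset n) → x △ (x △ y) ≡ y
△-cancelˡ = △.\\-leftDividesˡ

△-cancelʳ : ∀ {n} (x y : Subset n) → (x △ y) △ y ≡ x
△-cancelʳ x y = △.//-rightDividesʳ y x

△-transpose : ∀ {n} {x y z : Subset n} → x ≡ y △ z ⇔ z ≡ x △ y
△-transpose {x = x} {y} {z} = mk⇔
  (λ x≡y△z → sym (begin
    x △ y       ≡⟨ cong (_△ y) x≡y△z ⟩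
    y △ z △ y   ≡⟨ cong (_△ y) (△.comm y z) ⟩
    z △ y △ y   ≡⟨ △-cancelʳ z y ⟩
    z           ∎))
  (λ z≡x△y → sym (begin
    y △ z       ≡⟨ cong (y △_) z≡x△y ⟩
    y △ (x △ y) ≡⟨ cong (y △_) (△.comm x y) ⟩
    y △ (y △ x) ≡⟨ △-cancelˡ y x ⟩
    x           ∎))
  where open ≡-Reasoning

lookup-△ : ∀ {n} (S T : Subset n) i → lookup (S △ T) i ≡ (lookup S i xor lookup T i)
lookup-△ S T i = lookup-zipWith _xor_ i S T

lookup-⁅⁆ : ∀ {n} (j : Fin n) → lookup ⁅ j ⁆ j ≡ true
lookup-⁅⁆ j = []=⇒lookup (x∈⁅x⁆ j)

transvection : ∀ {k} → Fin k → Subset k → Subset k → Subset k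
transvection j a T = if lookup T j then a △ T else T

module _ {k} {j : Fin k} {a : Subset k} where

  transvection-∉ : ∀ {T} → lookup T j ≡ false → transvection j a T ≡ T
  transvection-∉ {T} T∌j = cong (if_then a △ T else T) T∌j

  transvection-∈ : ∀ {T} → lookup T j ≡ true → transvection j a T ≡ a △ T
  transvection-∈ {T} T∋j = cong (if_then a △ T else T) T∋j

  transvection-involutive : lookup a j ≡ false → ∀ T → transvection j a (transvection j a T) ≡ T
  transvection-involutive a∌j T with lookup T j in T∋j
  ... | false = transvection-∉ T∋j
  ... | true  = begin
    transvection j a (a △ T) ≡⟨ transvection-∈ (trans (lookup-△ a T j) (cong₂ _xor_ a∌j T∋j)) ⟩
    a △ (a △ T)              ≡⟨ △-cancelˡ a T ⟩
    T                        ∎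
    where open ≡-Reasoning

linComb : ∀ {m k} → Vector (Subset m) k → Subset k → Subset m
linComb B []      = ⊥
linComb B (s ∷ S) = if s then B zero △ linComb (tail B) S else linComb (tail B) S

module _ {m : ℕ} where

  linComb-⊥ : ∀ {k} (B : Vector (Subset m) k) → linComb B ⊥ ≡ ⊥
  linComb-⊥ {zero}  B = refl
  linComb-⊥ {suc k} B = linComb-⊥ (tail B)

  linComb-△ : ∀ {k} (B : Vector (Subset m) k) S T → linComb B (S △ T) ≡ linComb B S △ linComb B T
  linComb-△ B []          []          = sym (△.identityˡ ⊥)
  linComb-△ B (true ∷ S)  (true ∷ T)  = begin
    linComb (tail B) (S △ T)    ≡⟨ linComb-△ (tail B) S T ⟩
    S′ △ T′                     ≡⟨ △.identityˡ (S′ △ T′) ⟨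
    ⊥ △ (S′ △ T′)               ≡⟨ cong (_△ (S′ △ T′)) (△-self (B zero)) ⟨
    B zero △ B zero △ (S′ △ T′) ≡⟨ △.interchange (B zero) (B zero) S′ T′ ⟩
    B zero △ S′ △ (B zero △ T′) ∎
    where
    open ≡-Reasoning
    S′ T′ : Subset m
    S′ = linComb (tail B) S
    T′ = linComb (tail B) T
  linComb-△ B (true ∷ S)  (false ∷ T) =
    trans (cong (B zero △_) (linComb-△ (tail B) S T)) (sym (△.assoc _ _ _))
  linComb-△ B (false ∷ S) (true ∷ T)  =
    trans (cong (B zero △_) (linComb-△ (tail B) S T)) (△.x∙yz≈y∙xz _ _ _)
  linComb-△ B (false ∷ S) (false ∷ T) = linComb-△ (tail B) S T

  linComb-updateAt-∉ : ∀ {k} (B : Vector (Subset m) k) {f} j T → lookup T j ≡ false →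
                       linComb (updateAt B j f) T ≡ linComb B T
  linComb-updateAt-∉ B zero    (false ∷ T) _   = refl
  linComb-updateAt-∉ B (suc j) (true ∷ T)  T∌j = cong (B zero △_) (linComb-updateAt-∉ (tail B) j T T∌j)
  linComb-updateAt-∉ B (suc j) (false ∷ T) T∌j = linComb-updateAt-∉ (tail B) j T T∌j

  linComb-updateAt-∈ : ∀ {k} (B : Vector (Subset m) k) {f} j T → lookup T j ≡ true →
                       linComb (updateAt B j f) T ≡ f (B j) △ linComb B (⁅ j ⁆ △ T)
  linComb-updateAt-∈ B {f} zero (true ∷ T) _ =
    cong (λ T′ → f (B zero) △ linComb (tail B) T′) (sym (△.identityˡ T))
  linComb-updateAt-∈ B (suc j) (true ∷ T) T∋j =
    trans (cong (B zero △_) (linComb-updateAt-∈ (tail B) j T T∋j)) (△.x∙yz≈y∙xz _ _ _)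
  linComb-updateAt-∈ B (suc j) (false ∷ T) T∋j = linComb-updateAt-∈ (tail B) j T T∋j

sum-tabulate-updateAt-< : ∀ {k} (f : Vector ℕ k) j {h : ℕ → ℕ} → h (f j) < f j →
                          sum (tabulate (updateAt f j h)) < sum (tabulate f)
sum-tabulate-updateAt-< f zero    lt = +-monoˡ-< _ lt
sum-tabulate-updateAt-< f (suc j) lt = +-monoʳ-< (f zero) (sum-tabulate-updateAt-< (tail f) j lt)

module _ (G : Graph) where

  ShortCycle : ℕ → EdgeSet G → Set
  ShortCycle L C = IsCycle G C × len G C < L

  SupportedBelow : ∀ {k} → Vector (EdgeSet G) k → ℕ → Subset k → Set
  SupportedBelow M L T = ∀ i → lookup T i ≡ true → len G (M i) < L

  sumSel≡linComb : ∀ {k} (B : Vector (EdgeSet G) k) S → sumSel G B S ≡ linComb B S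
  sumSel≡linComb B []      = refl
  sumSel≡linComb B (s ∷ S) = cong (λ X → if s then B zero △ X else X) (begin
    foldr step ⊥ (tabulate suc)       ≡⟨ cong (foldr step ⊥) (sym (map-tabulate id suc)) ⟩
    foldr step ⊥ (map suc (allFin _)) ≡⟨ foldr-map step suc ⊥ (allFin _) ⟩
    sumSel G (tail B) S               ≡⟨ sumSel≡linComb (tail B) S ⟩
    linComb (tail B) S                ∎)
    where
    open ≡-Reasoning
    step : Fin _ → EdgeSet G → EdgeSet G
    step i acc = if lookup (s ∷ S) i then B i △ acc else acc

  module _ {k} (B : Vector (EdgeSet G) k) where

    expansion-⊥ : IsExpansion G B ⊥ ⊥
    expansion-⊥ = trans (sumSel≡linComb B ⊥) (linComb-⊥ B)

    expansion-△ : ∀ {C D} S T → IsExpansion G B C S → IsExpansion G B D T → IsExpansion G B (C △ D) (S △ T)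
    expansion-△ S T B·S≡C B·T≡D = begin
      sumSel G B (S △ T)          ≡⟨ sumSel≡linComb B (S △ T) ⟩
      linComb B (S △ T)           ≡⟨ linComb-△ B S T ⟩
      linComb B S △ linComb B T   ≡⟨ cong₂ _△_ (sym (sumSel≡linComb B S)) (sym (sumSel≡linComb B T)) ⟩
      sumSel G B S △ sumSel G B T ≡⟨ cong₂ _△_ B·S≡C B·T≡D ⟩
      _                           ∎
      where open ≡-Reasoning

    expansion-unique : IsBasis G B → ∀ {C} S T → IsExpansion G B C S → IsExpansion G B C T → S ≡ T
    expansion-unique basis {C} S T B·S≡C B·T≡C =
      △.x∙y⁻¹≈ε⇒x≈y S T (IsBasis.independent basis (S △ T) (begin
        sumSel G B (S △ T) ≡⟨ expansion-△ S T B·S≡C B·T≡C ⟩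
        C △ C              ≡⟨ △-self C ⟩
        ⊥                  ∎))
      where open ≡-Reasoning

  isBasis-via-involution : ∀ {k} {M B : Vector (EdgeSet G) k} → IsBasis G M → (∀ i → IsCycle G (B i)) →
    (σ : Subset k → Subset k) → (∀ T → σ (σ T) ≡ T) → (∀ T → linComb B T ≡ linComb M (σ T)) → IsBasis G B
  isBasis-via-involution {M = M} {B} basis cycles σ σσ≡id B≡M∘σ = record
    { cycles = cycles ; independent = independent ; spanning = spanning }
    where
    open ≡-Reasoning

    expansion-σ : ∀ {C} T → IsExpansion G B C T → IsExpansion G M C (σ T)
    expansion-σ {C} T B·T≡C = begin
      sumSel G M (σ T) ≡⟨ sumSel≡linComb M (σ T) ⟩
      linComb M (σ T)  ≡⟨ B≡M∘σ T ⟨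
      linComb B T      ≡⟨ sumSel≡linComb B T ⟨
      sumSel G B T     ≡⟨ B·T≡C ⟩
      C                ∎

    independent : ∀ T → sumSel G B T ≡ ⊥ → T ≡ ⊥
    independent T B·T≡⊥ = begin
      T         ≡⟨ sym (σσ≡id T) ⟩
      σ (σ T)   ≡⟨ cong σ (expansion-unique M basis (σ T) (σ ⊥) (expansion-σ T B·T≡⊥) (expansion-σ ⊥ (expansion-⊥ B))) ⟩
      σ (σ ⊥)   ≡⟨ σσ≡id ⊥ ⟩
      ⊥         ∎

    spanning : ∀ D → IsCycle G D → ∃[ T ] sumSel G B T ≡ D
    spanning D cycD with IsBasis.spanning basis D cycD
    ... | T , M·T≡D = σ T , (begin
      sumSel G B (σ T)      ≡⟨ sumSel≡linComb B (σ T) ⟩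
      linComb B (σ T)       ≡⟨ B≡M∘σ (σ T) ⟩
      linComb M (σ (σ T))   ≡⟨ cong (linComb M) (σσ≡id T) ⟩
      linComb M T           ≡⟨ sym (sumSel≡linComb M T) ⟩
      sumSel G M T          ≡⟨ M·T≡D ⟩
      D                     ∎)

  isBasis-exchange : ∀ {k} {M : Vector (EdgeSet G) k} {C S j} → IsBasis G M → IsCycle G C →
    IsExpansion G M C S → lookup S j ≡ true → IsBasis G (updateAt M j (const C))
  isBasis-exchange {M = M} {C} {S} {j} basis cycC M·S≡C S∋j =
    isBasis-via-involution basis cycles′ (transvection j a) (transvection-involutive a∌j) exchanged
    where
    a : Subset _
    a = S △ ⁅ j ⁆

    a∌j : lookup a j ≡ false
    a∌j = trans (lookup-△ S ⁅ j ⁆ j) (cong₂ _xor_ S∋j (lookup-⁅⁆ j))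

    cycles′ : ∀ i → IsCycle G (updateAt M j (const C) i)
    cycles′ i with i ≟ j
    ... | yes refl = subst (IsCycle G) (sym (updateAt-updates j M)) cycC
    ... | no  i≢j  = subst (IsCycle G) (sym (updateAt-minimal i j M i≢j)) (IsBasis.cycles basis i)

    exchanged : ∀ T → linComb (updateAt M j (const C)) T ≡ linComb M (transvection j a T)
    exchanged T with lookup T j in T∋j
    ... | false = linComb-updateAt-∉ M j T T∋j
    ... | true  = begin
      linComb (updateAt M j (const C)) T   ≡⟨ linComb-updateAt-∈ M j T T∋j ⟩
      C △ linComb M (⁅ j ⁆ △ T)             ≡⟨ cong (_△ _) (trans (sym M·S≡C) (sumSel≡linComb M S)) ⟩
      linComb M S △ linComb M (⁅ j ⁆ △ T)   ≡⟨ sym (linComb-△ M S _) ⟩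
      linComb M (S △ (⁅ j ⁆ △ T))           ≡⟨ cong (linComb M) (sym (△.assoc S ⁅ j ⁆ T)) ⟩
      linComb M (a △ T)                    ∎
      where open ≡-Reasoning

  weight-updateAt-< : ∀ {k} (M : Vector (EdgeSet G) k) j {C} → len G C < len G (M j) →
                      weight G (updateAt M j (const C)) < weight G M
  weight-updateAt-< M j {C} C<Mj = begin-strict
    weight G (updateAt M j (const C))                            ≡⟨ weight≡ (updateAt M j (const C)) ⟩
    sum (tabulate (len G ∘ updateAt M j (const C)))             ≡⟨ cong sum (tabulate-cong (map-updateAt-local {f = len G} M j refl)) ⟩
    sum (tabulate (updateAt (len G ∘ M) j (const (len G C))))   <⟨ sum-tabulate-updateAt-< (len G ∘ M) j C<Mj ⟩
    sum (tabulate (len G ∘ M))                                   ≡⟨ weight≡ M ⟨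
    weight G M                                                   ∎
    where
    open ≤-Reasoning
    weight≡ : (B : Vector (EdgeSet G) _) → weight G B ≡ sum (tabulate (len G ∘ B))
    weight≡ B = cong sum (map-tabulate id (len G ∘ B))

  mcb-expansion-≤ : ∀ {k} {M : Vector (EdgeSet G) k} {C S j} → IsMCB G M → IsCycle G C →
    IsExpansion G M C S → lookup S j ≡ true → len G (M j) ≤ len G C
  mcb-expansion-≤ {M = M} {C} {S} {j} (basis , minimal) cycC M·S≡C S∋j = ≮⇒≥ λ C<Mj →
    <⇒≱ (weight-updateAt-< M j C<Mj) (minimal _ (isBasis-exchange {C = C} {S} basis cycC M·S≡C S∋j))

  module _ {k} {M : Vector (EdgeSet G) k} {L : ℕ} where

    supportedBelow-⊥ : SupportedBelow M L ⊥
    supportedBelow-⊥ i ⊥∋i = contradiction (trans (sym ⊥∋i) (lookup-replicate i false)) λ ()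

    supportedBelow-△ : ∀ S T → SupportedBelow M L S → SupportedBelow M L T → SupportedBelow M L (S △ T)
    supportedBelow-△ S T S-short T-short i S△T∋i with lookup S i in S∋i
    ... | true  = S-short i S∋i
    ... | false = T-short i (trans (sym (trans (lookup-△ S T i) (cong (_xor lookup T i) S∋i))) S△T∋i)

    ⨁-short-expansion : IsMCB G M → ∀ {Y} → All (ShortCycle L) Y →
      ∃[ T ] IsExpansion G M (⨁ G Y) T × SupportedBelow M L T
    ⨁-short-expansion mcb [] = ⊥ , expansion-⊥ M , supportedBelow-⊥
    ⨁-short-expansion mcb {C ∷ _} ((cycC , C<L) ∷ shortY)
      with IsBasis.spanning (proj₁ mcb) C cycC | ⨁-short-expansion mcb shortY
    ... | S , M·S≡C | T , M·T≡⨁Y , T-short =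
      S △ T , expansion-△ M S T M·S≡C M·T≡⨁Y ,
      supportedBelow-△ S T (λ i S∋i → ≤-<-trans (mcb-expansion-≤ {S = S} mcb cycC M·S≡C S∋i) C<L) T-short

  linComb-as-⨁ : ∀ {k} (P : EdgeSet G → Set) (B : Vector (EdgeSet G) k) T → (∀ i → lookup T i ≡ true → P (B i)) →
    ∃[ Y ] All P Y × ⨁ G Y ≡ linComb B T
  linComb-as-⨁ P B []          _   = [] , [] , refl
  linComb-as-⨁ P B (true ∷ T)  P-T with linComb-as-⨁ P (tail B) T (P-T ∘ suc)
  ... | Y , PY , ⨁Y≡B·T = B zero ∷ Y , P-T zero refl ∷ PY , cong (B zero △_) ⨁Y≡B·T
  linComb-as-⨁ P B (false ∷ T) P-T = linComb-as-⨁ P (tail B) T (P-T ∘ suc)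

  ⨁-short⇔supportedBelow : ∀ {k} {M : Vector (EdgeSet G) k} {L D} → IsMCB G M → ∀ T → IsExpansion G M D T →
    (∃[ Y ] All (ShortCycle L) Y × ⨁ G Y ≡ D) ⇔ SupportedBelow M L T
  ⨁-short⇔supportedBelow {M = M} {L} {D} mcb T M·T≡D = mk⇔ to from
    where
    to : ∃[ Y ] All (ShortCycle L) Y × ⨁ G Y ≡ D → SupportedBelow M L T
    to (Y , shortY , ⨁Y≡D) with ⨁-short-expansion mcb shortY
    ... | T′ , M·T′≡⨁Y , T′-short =
      subst (SupportedBelow M L) (expansion-unique M (proj₁ mcb) T′ T (trans M·T′≡⨁Y ⨁Y≡D) M·T≡D) T′-short

    from : SupportedBelow M L T → ∃[ Y ] All (ShortCycle L) Y × ⨁ G Y ≡ D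
    from T-short with linComb-as-⨁ (ShortCycle L) M T (λ i T∋i → IsBasis.cycles (proj₁ mcb) i , T-short i T∋i)
    ... | Y , shortY , ⨁Y≡M·T = Y , shortY , trans ⨁Y≡M·T (trans (sym (sumSel≡linComb M T)) M·T≡D)

  interchangeable⇔⨁-short : ∀ {C₁ C₂} →
    ShortLoopInterchangeable G C₁ C₂ ⇔ (∃[ Y ] All (ShortCycle (len G C₁)) Y × ⨁ G Y ≡ C₁ △ C₂)
  interchangeable⇔⨁-short =
    mk⇔ (map₂ (map₂ (Equivalence.to △-transpose))) (map₂ (map₂ (Equivalence.from △-transpose)))

lemma8 : (G : Graph) {k : ℕ} (M : Vector (EdgeSet G) k) → IsMCB G M →
    (C₁ C₂ : EdgeSet G) → Relevant G C₁ → Relevant G C₂ → len G C₁ ≡ len G C₂ →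
    (S₁ S₂ : Subset k) → IsExpansion G M C₁ S₁ → IsExpansion G M C₂ S₂ →
    ShortLoopInterchangeable G C₁ C₂
      ⇔ (∀ (i : Fin k) → (lookup S₁ i xor lookup S₂ i) ≡ true → len G (M i) < len G C₁)
lemma8 G M mcb C₁ C₂ _ _ _ S₁ S₂ M·S₁≡C₁ M·S₂≡C₂ =
  ⇔-trans (interchangeable⇔⨁-short G)
    (⇔-trans (⨁-short⇔supportedBelow G mcb (S₁ △ S₂) (expansion-△ G M S₁ S₂ M·S₁≡C₁ M·S₂≡C₂))
      (mk⇔ (λ short i → short i ∘ trans (lookup-△ S₁ S₂ i))
           (λ short i → short i ∘ trans (sym (lookup-△ S₁ S₂ i)))))
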